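{- Let $T$ be a tree with at least $3$ vertices, no vertex of degree $2$, and exactly $3k$ leaves ($k\ge1$). Run a depth-first search starting from a leaf and name the leaves in order of their first appearance as $a_1,\dots,a_k,b_1,\dots,b_k,c_1,\dots,c_k$. For $i\in\{1,\dots,k\}$ let $P_i$ be the unique $a_i$-$b_i$-path and $Q_i$ the unique $a_i$-$c_i$-path in $T$. Then the family $\mathcal F=\{P_1,\dots,P_k,Q_1,\dots,Q_k\}$ separates and covers $E(T)$, and $|\mathcal F|=2k$.
   Context: A path contains the edges between its consecutive vertices. For a family $\mathcal F$ of paths and an edge $e$, $\mathcal F(e)$ is the set of paths of $\mathcal F$ containing $e$. $\mathcal F$ separates $E(T)$ if $\mathcal F(e)\ne\mathcal F(f)$ for all distinct edges $e,f$, and covers $E(T)$ if $\mathcal F(e)\ne\emptyset$ for all edges $e$. -}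

module Defs where

open import Data.Nat using (ℕ; _≡ᵇ_)
open import Data.Bool using (Bool; true; false)
open import Data.Fin using (Fin; _<_)
open import Data.List using (List; []; _∷_; _++_; length; filterᵇ; head; last; map)
open import Data.List.Relation.Unary.Linked using (Linked)
open import Data.List.Relation.Unary.All using (All)
open import Data.List.Relation.Unary.Unique.Propositional using (Unique)
open import Data.List.Membership.Propositional using (_∈_)
open import Data.Maybe using (Maybe; just)
open import Data.Product using (Σ; ∃; ∃₂; _×_; _,_)
open import Data.Sum using (_⊎_; inj₁; inj₂)
open import Data.List using () renaming (tabulate to tabulateL)
open import Relation.Binary.PropositionalEquality using (_≡_; _≢_)
open import Relation.Nullary using (¬_)
open import Function using (_⇔_; id)

record Graph (n : ℕ) : Set where
  field
    adj    : Fin n → Fin n → Bool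
    sym    : ∀ u v → adj u v ≡ adj v u
    irrefl : ∀ v → adj v v ≡ false
open Graph public

module _ {n : ℕ} (G : Graph n) where

  Adj : Fin n → Fin n → Set
  Adj u v = adj G u v ≡ true

  vertices : List (Fin n)
  vertices = tabulateL id

  deg : Fin n → ℕ
  deg v = length (filterᵇ (adj G v) vertices)

  isLeafᵇ : Fin n → Bool
  isLeafᵇ v = deg v ≡ᵇ 1

  numLeaves : ℕ
  numLeaves = length (filterᵇ isLeafᵇ vertices)

  IsPath : Fin n → Fin n → List (Fin n) → Set
  IsPath u v xs = Linked Adj xs × Unique xs × head xs ≡ just u × last xs ≡ just v

  IsCycle : List (Fin n) → Set
  IsCycle xs = ∃₂ λ x y → ∃₂ λ z zs → xs ≡ x ∷ y ∷ z ∷ zs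
             × Linked Adj xs × Unique xs × (∀ w → last xs ≡ just w → Adj w x)

  Connected : Set
  Connected = ∀ u v → ∃ λ xs → IsPath u v xs

  Acyclic : Set
  Acyclic = ∀ xs → ¬ IsCycle xs

  IsTree : Set
  IsTree = Connected × Acyclic

  -- Depth-first search order: the list of vertices in order of discovery, starting at r.
  -- It lists every vertex exactly once, and each vertex v other than the first is discovered
  -- from the most recently discovered vertex u that still has an undiscovered neighbour
  -- (all vertices discovered after u have no undiscovered neighbours).
  IsDFSOrder : Fin n → List (Fin n) → Set
  IsDFSOrder r ord =
    head ord ≡ just r × Unique ord × (∀ v → v ∈ ord) ×
    (∀ pre v post → ord ≡ pre ++ v ∷ post → pre ≢ [] →
       ∃₂ λ pre₁ u → ∃ λ pre₂ → pre ≡ pre₁ ++ u ∷ pre₂ × Adj u v ×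
         All (λ w → ∀ z → Adj w z → z ∈ pre) pre₂)

  IsDFSFromLeaf : List (Fin n) → Set
  IsDFSFromLeaf ord = ∃ λ r → deg r ≡ 1 × IsDFSOrder r ord

  leavesInOrder : List (Fin n) → List (Fin n)
  leavesInOrder ord = filterᵇ isLeafᵇ ord

  data ConsecIn (x y : Fin n) : List (Fin n) → Set where
    here  : ∀ {zs} → ConsecIn x y (x ∷ y ∷ zs)
    there : ∀ {z zs} → ConsecIn x y zs → ConsecIn x y (z ∷ zs)

  EdgeIn : Fin n → Fin n → List (Fin n) → Set
  EdgeIn x y xs = ConsecIn x y xs ⊎ ConsecIn y x xs

  IsEdge : Fin n → Fin n → Set
  IsEdge x y = x < y × Adj x y

  Covers : {I : Set} → (I → List (Fin n)) → Set
  Covers {I} F = ∀ x y → IsEdge x y → ∃ λ (j : I) → EdgeIn x y (F j)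

  Separates : {I : Set} → (I → List (Fin n)) → Set
  Separates {I} F = ∀ x y x' y' → IsEdge x y → IsEdge x' y' → (x , y) ≢ (x' , y') →
    ¬ (∀ (j : I) → EdgeIn x y (F j) ⇔ EdgeIn x' y' (F j))

family : {k : ℕ} {A : Set} → (Fin k → A) → (Fin k → A) → Fin k ⊎ Fin k → A
family P Q (inj₁ i) = P i
family P Q (inj₂ i) = Q i

-- Root the tree at the first vertex r of the DFS order, a leaf. Cutting an edge xy, x the parent of y,
-- leaves the subtree of y, which occupies a block [pos y, end) of the DFS order, so its leaves form an
-- interval [s, t) of the leaf order with 1 ≤ s < t ≤ 3k. A path between two leaves uses xy iff exactly
-- one of them lies below y; hence P_i (resp. Q_i) uses xy iff exactly one of i, k + i (resp. i, 2k + i)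
-- lies in [s, t). A periodicity argument shows that these 2k bits never all vanish and determine
-- [s, t), and since no vertex has degree 2, distinct edges have distinct sets of leaves below them.

module Submission where

open import Defs hiding (sym)

open import Data.Bool using (Bool; true; false; not; T; _∧_; _xor_)
open import Data.Bool.Properties
  using (_≟_; ¬-not; not-injective; T-≡; xor-comm; xor-assoc; xor-same; xor-identityʳ; xor-inverseˡ)
open import Data.Empty using (⊥; ⊥-elim)
open import Data.Fin using (Fin; toℕ; fromℕ<) renaming (zero to fzero; suc to fsuc; _≟_ to _≟F_)
open import Data.Fin.Properties using (toℕ-fromℕ<; toℕ-injective; toℕ<n; any?) renaming (<-asym to <F-asym)
open import Data.List using (List; []; _∷_; _++_; length; take; drop; filterᵇ; head; last)
open import Data.List.Properties using (length-++)
open import Data.List.Membership.Propositional using (_∈_; _∉_)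
open import Data.List.Membership.Propositional.Properties using (∈-filter⁺; ∈-filter⁻; ∈-tabulate⁺)
open import Data.List.Relation.Unary.All using ([]; _∷_)
import Data.List.Relation.Unary.All as All
open import Data.List.Relation.Unary.All.Properties using (¬Any⇒All¬; All¬⇒¬Any)
open import Data.List.Relation.Unary.AllPairs using ([]; _∷_)
open import Data.List.Relation.Unary.Any using (here; there)
open import Data.List.Relation.Unary.Linked using (Linked; [-]; _∷_) renaming (map to Linked-map)
open import Data.List.Relation.Unary.Unique.Propositional using (Unique)
open import Data.List.Relation.Unary.Unique.Propositional.Properties using (filter⁺; tabulate⁺)
open import Data.Maybe using (Maybe; just; nothing; maybe)
open import Data.Maybe.Properties using (just-injective)
open import Data.Nat using (ℕ; zero; suc; _+_; _*_; _≤_; _<_; _≤ᵇ_; _<ᵇ_; _≡ᵇ_; z≤n; s≤s)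
open import Data.Nat.Properties hiding (_≟_)
open import Data.Nat.Properties using () renaming (_≟_ to _≟ℕ_)
open import Data.Product using (Σ; ∃; ∃₂; _×_; _,_; proj₁; proj₂; uncurry)
open import Data.Sum using (_⊎_; inj₁; inj₂; [_,_]′) renaming (map to ⊎-map)
open import Data.Vec using (Vec; lookup; toList) renaming (_∷_ to _∷ᵛ_)
open import Data.Vec.Properties using (length-toList)
open import Function using (_∘_; id)
open import Function.Bundles using (Equivalence; _⇔_; mk⇔)
open import Function.Definitions using (Injective)
open import Function.Properties.Equivalence using () renaming (trans to ⇔-trans; sym to ⇔-sym)
open import Relation.Binary.Construct.Closure.ReflexiveTransitive using (Star; ε; _◅_; _◅◅_; reverse)
  renaming (map to Star-map)
open import Relation.Binary.Definitions using (tri<; tri≈; tri>)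
open import Relation.Binary.PropositionalEquality
open import Relation.Nullary using (¬_; Dec; yes; no)
open import Relation.Nullary.Decidable using (_⊎-dec_; _×-dec_; T?)

module _ {A : Set} where

  infixl 9 _‼_
  _‼_ : List A → ℕ → Maybe A
  []       ‼ _     = nothing
  (x ∷ xs) ‼ zero  = just x
  (x ∷ xs) ‼ suc i = xs ‼ i

  ‼⇒<length : ∀ xs i {w} → xs ‼ i ≡ just w → i < length xs
  ‼⇒<length (x ∷ xs) zero    _ = s≤s z≤n
  ‼⇒<length (x ∷ xs) (suc i) e = s≤s (‼⇒<length xs i e)

  ‼⇒∈ : ∀ xs i {w} → xs ‼ i ≡ just w → w ∈ xs
  ‼⇒∈ (x ∷ xs) zero    refl = here refl
  ‼⇒∈ (x ∷ xs) (suc i) e    = there (‼⇒∈ xs i e)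

  ∈⇒‼ : ∀ {xs w} → w ∈ xs → ∃ λ i → xs ‼ i ≡ just w
  ∈⇒‼ (here refl) = zero , refl
  ∈⇒‼ (there w∈)  = let i , e = ∈⇒‼ w∈ in suc i , e

  <length⇒‼ : ∀ xs i → i < length xs → ∃ λ w → xs ‼ i ≡ just w
  <length⇒‼ (x ∷ xs) zero    _       = x , refl
  <length⇒‼ (x ∷ xs) (suc i) (s≤s p) = <length⇒‼ xs i p

  ≥length⇒‼ : ∀ xs i → length xs ≤ i → xs ‼ i ≡ nothing
  ≥length⇒‼ []       i       _       = refl
  ≥length⇒‼ (x ∷ xs) (suc i) (s≤s p) = ≥length⇒‼ xs i p

  ‼-++ˡ : ∀ xs ys i {w} → xs ‼ i ≡ just w → (xs ++ ys) ‼ i ≡ just w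
  ‼-++ˡ (x ∷ xs) ys zero    e = e
  ‼-++ˡ (x ∷ xs) ys (suc i) e = ‼-++ˡ xs ys i e

  ‼-++ʳ : ∀ xs ys j → (xs ++ ys) ‼ (length xs + j) ≡ ys ‼ j
  ‼-++ʳ []       ys j = refl
  ‼-++ʳ (x ∷ xs) ys j = ‼-++ʳ xs ys j

  ‼-take⁺ : ∀ xs m i {w} → i < m → xs ‼ i ≡ just w → take m xs ‼ i ≡ just w
  ‼-take⁺ (x ∷ xs) (suc m) zero    _         e = e
  ‼-take⁺ (x ∷ xs) (suc m) (suc i) (s≤s i<m) e = ‼-take⁺ xs m i i<m e

  ‼-take⁻ : ∀ xs m i {w} → take m xs ‼ i ≡ just w → i < m × xs ‼ i ≡ just w
  ‼-take⁻ (x ∷ xs) (suc m) zero    e = s≤s z≤n , e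
  ‼-take⁻ (x ∷ xs) (suc m) (suc i) e = let i<m , e′ = ‼-take⁻ xs m i e in s≤s i<m , e′

  ‼-split : ∀ xs m {v} → xs ‼ m ≡ just v → xs ≡ take m xs ++ v ∷ drop (suc m) xs
  ‼-split (x ∷ xs) zero    refl = refl
  ‼-split (x ∷ xs) (suc m) e    = cong (x ∷_) (‼-split xs m e)

  Unique⇒‼-injective : ∀ {xs} → Unique xs → ∀ i j {w} → xs ‼ i ≡ just w → xs ‼ j ≡ just w → i ≡ j
  Unique⇒‼-injective {x ∷ xs} _          zero    zero    _    _    = refl
  Unique⇒‼-injective {x ∷ xs} (x∉ ∷ _)   zero    (suc j) refl e    = ⊥-elim (All.lookup x∉ (‼⇒∈ xs j e) refl)
  Unique⇒‼-injective {x ∷ xs} (x∉ ∷ _)   (suc i) zero    e    refl = ⊥-elim (All.lookup x∉ (‼⇒∈ xs i e) refl)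
  Unique⇒‼-injective {x ∷ xs} (_ ∷ uniq) (suc i) (suc j) e    e′   = cong suc (Unique⇒‼-injective uniq i j e e′)

  toList-‼ : ∀ {k} (v : Vec A k) i → toList v ‼ toℕ i ≡ just (lookup v i)
  toList-‼ (x ∷ᵛ v) fzero    = refl
  toList-‼ (x ∷ᵛ v) (fsuc i) = toList-‼ v i

  ‼-toList-++ : ∀ {k} (v : Vec A k) ys j → (toList v ++ ys) ‼ (k + j) ≡ ys ‼ j
  ‼-toList-++ v ys j = subst (λ m → (toList v ++ ys) ‼ (m + j) ≡ ys ‼ j) (length-toList v) (‼-++ʳ (toList v) ys j)

module _ {A : Set} (p : A → Bool) where

  rank : List A → ℕ → ℕ
  rank xs i = length (filterᵇ p (take i xs))

  rank-mono : ∀ xs {i j} → i ≤ j → rank xs i ≤ rank xs j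
  rank-mono xs       {zero}  _         = z≤n
  rank-mono []       {suc i} _         = z≤n
  rank-mono (x ∷ xs) {suc i} (s≤s i≤j) with p x
  ... | true  = s≤s (rank-mono xs i≤j)
  ... | false = rank-mono xs i≤j

  rank-suc : ∀ xs m {w} → xs ‼ m ≡ just w → p w ≡ true → rank xs (suc m) ≡ suc (rank xs m)
  rank-suc (x ∷ xs) zero    refl pw rewrite pw = refl
  rank-suc (x ∷ xs) (suc m) e    pw with p x
  ... | true  = cong suc (rank-suc xs m e pw)
  ... | false = rank-suc xs m e pw

  rank-strict : ∀ xs {m a w} → xs ‼ m ≡ just w → p w ≡ true → m < a → rank xs m < rank xs a
  rank-strict xs {m} {a} e pw m<a = subst (_≤ rank xs a) (rank-suc xs m e pw) (rank-mono xs m<a)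

  rank≤length-filter : ∀ xs i → rank xs i ≤ length (filterᵇ p xs)
  rank≤length-filter xs       zero    = z≤n
  rank≤length-filter []       (suc i) = z≤n
  rank≤length-filter (x ∷ xs) (suc i) with p x
  ... | true  = s≤s (rank≤length-filter xs i)
  ... | false = rank≤length-filter xs i

  filter-‼-rank : ∀ xs m {w} → xs ‼ m ≡ just w → p w ≡ true → filterᵇ p xs ‼ rank xs m ≡ just w
  filter-‼-rank (x ∷ xs) zero    refl pw rewrite pw = refl
  filter-‼-rank (x ∷ xs) (suc m) e    pw with p x
  ... | true  = filter-‼-rank xs m e pw
  ... | false = filter-‼-rank xs m e pw

  ‼-filter⁻ : ∀ xs j {w} → filterᵇ p xs ‼ j ≡ just w → ∃ λ m → xs ‼ m ≡ just w × rank xs m ≡ j × p w ≡ true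
  ‼-filter⁻ (x ∷ xs) j e with p x in px
  ‼-filter⁻ (x ∷ xs) zero    refl | true = zero , refl , refl , px
  ‼-filter⁻ (x ∷ xs) (suc j) e    | true with ‼-filter⁻ xs j e
  ... | m , e′ , rk , pw = suc m , e′ , rank-cons , pw
    where rank-cons : length (filterᵇ p (x ∷ take m xs)) ≡ suc j
          rank-cons rewrite px = cong suc rk
  ‼-filter⁻ (x ∷ xs) j e | false with ‼-filter⁻ xs j e
  ... | m , e′ , rk , pw = suc m , e′ , rank-cons , pw
    where rank-cons : length (filterᵇ p (x ∷ take m xs)) ≡ j
          rank-cons rewrite px = rk

true≢false : true ≢ false
true≢false ()

T⇒≡true : ∀ {b} → T b → b ≡ true
T⇒≡true = Equivalence.to T-≡

≡true⇒T : ∀ {b} → b ≡ true → T b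
≡true⇒T = Equivalence.from T-≡

∧-true⁻ : ∀ {x y} → x ∧ y ≡ true → x ≡ true × y ≡ true
∧-true⁻ {true} e = refl , e

Bool-⇔⇒≡ : ∀ {a b} → (a ≡ true ⇔ b ≡ true) → a ≡ b
Bool-⇔⇒≡ {true}  a⇔b = sym (Equivalence.to a⇔b refl)
Bool-⇔⇒≡ {false} {true}  a⇔b = Equivalence.from a⇔b refl
Bool-⇔⇒≡ {false} {false} a⇔b = refl

xor-solveʳ : ∀ x {y z} → x xor y ≡ z → y ≡ x xor z
xor-solveʳ false          e    = e
xor-solveʳ true  {true}  refl = refl
xor-solveʳ true  {false} refl = refl

xor≡false⇒≡ : ∀ x {y} → x xor y ≡ false → y ≡ x
xor≡false⇒≡ x e = trans (xor-solveʳ x e) (xor-identityʳ x)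

xor-interchange : ∀ a b c d → a xor b ≡ c xor d → a xor c ≡ b xor d
xor-interchange a b c d e = begin
  a xor c                       ≡⟨ cong (_xor c) (xor-solveʳ b (trans (xor-comm b a) e)) ⟩
  (b xor (c xor d)) xor c       ≡⟨ xor-assoc b (c xor d) c ⟩
  b xor ((c xor d) xor c)       ≡⟨ cong (b xor_) (trans (cong (_xor c) (xor-comm c d)) (xor-assoc d c c)) ⟩
  b xor (d xor (c xor c))       ≡⟨ cong (λ x → b xor (d xor x)) (xor-same c) ⟩
  b xor (d xor false)           ≡⟨ cong (b xor_) (xor-identityʳ d) ⟩
  b xor d                       ∎
  where open ≡-Reasoning

Least : (ℕ → Bool) → ℕ → Set
Least g l = g l ≡ true × (∀ j → j < l → g j ≡ false)

module _ (g : ℕ → Bool) where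

  private
    search : ∀ m → (∃ λ l → l ≤ m × Least g l)
                 ⊎ (∀ j → j ≤ m → g j ≡ false)
    search zero with g zero in e
    ... | true  = inj₁ (zero , z≤n , e , λ _ ())
    ... | false = inj₂ λ { zero _ → e }
    search (suc m) with search m
    ... | inj₁ (l , l≤m , gl , below) = inj₁ (l , m≤n⇒m≤1+n l≤m , gl , below)
    ... | inj₂ none with g (suc m) in e
    ...   | true  = inj₁ (suc m , ≤-refl , e , λ j j<1+m → none j (≤-pred j<1+m))
    ...   | false = inj₂ λ j j≤1+m → case-≤ j j≤1+m
      where
        case-≤ : ∀ j → j ≤ suc m → g j ≡ false
        case-≤ j j≤1+m with m≤n⇒m<n∨m≡n j≤1+m
        ... | inj₁ j<1+m = none j (≤-pred j<1+m)
        ... | inj₂ refl  = e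

  least-true : ∀ {m} → g m ≡ true → ∃ λ l → l ≤ m × Least g l
  least-true {m} gm with search m
  ... | inj₁ least = least
  ... | inj₂ none  = ⊥-elim (true≢false (trans (sym gm) (none m ≤-refl)))

-- Indicator functions of intervals

Convex : (ℕ → Bool) → Set
Convex f = ∀ {i j l} → i ≤ j → j ≤ l → f i ≡ true → f l ≡ true → f j ≡ true

private
  module ConvexRuns {f h : ℕ → Bool} (f-convex : Convex f) (h-convex : Convex h) where

    h-value : ∀ {j b c} → f j ≡ b → f j xor h j ≡ c → h j ≡ b xor c
    h-value {j} fj e = trans (xor-solveʳ (f j) e) (cong (_xor _) fj)

    f-value : ∀ {j b c} → h j ≡ b → f j xor h j ≡ c → f j ≡ b xor c
    f-value {j} hj e = trans (xor-solveʳ (h j) (trans (xor-comm (h j) (f j)) e)) (cong (_xor _) hj)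

    three-runs-from-f : ∀ {i₁ i₂ i₃ i₄ i₅} → i₁ ≤ i₂ → i₂ ≤ i₃ → i₃ ≤ i₄ → i₄ ≤ i₅ → f i₁ ≡ true →
      f i₂ xor h i₂ ≡ false → f i₃ xor h i₃ ≡ true → f i₄ xor h i₄ ≡ false → f i₅ xor h i₅ ≡ true → ⊥
    three-runs-from-f {i₂ = i₂} {i₃} {i₄} {i₅} p₁₂ p₂₃ p₃₄ p₄₅ f₁ g₂ g₃ g₄ g₅
      with f i₃ ≟ true | f i₅ ≟ true
    ... | yes f₃ | yes f₅ = true≢false (trans (sym (h-convex p₂₃ p₃₄ h₂ h₄)) (h-value f₃ g₃))
      where h₂ : h i₂ ≡ true
            h₂ = h-value (f-convex p₁₂ p₂₃ f₁ f₃) g₂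
            h₄ : h i₄ ≡ true
            h₄ = h-value (f-convex p₃₄ p₄₅ f₃ f₅) g₄
    ... | yes f₃ | no f₅≢ = true≢false (trans (sym (h-convex p₂₃ (≤-trans p₃₄ p₄₅) h₂ h₅)) (h-value f₃ g₃))
      where h₂ : h i₂ ≡ true
            h₂ = h-value (f-convex p₁₂ p₂₃ f₁ f₃) g₂
            h₅ : h i₅ ≡ true
            h₅ = h-value (¬-not f₅≢) g₅
    ... | no f₃≢ | yes f₅ = f₃≢ (f-convex (≤-trans p₁₂ p₂₃) (≤-trans p₃₄ p₄₅) f₁ f₅)
    ... | no f₃≢ | no f₅≢ = f₃≢ (f-convex (≤-trans p₁₂ p₂₃) p₃₄ f₁ (f-value h₄ g₄))
      where h₄ : h i₄ ≡ true
            h₄ = h-convex p₃₄ p₄₅ (h-value (¬-not f₃≢) g₃) (h-value (¬-not f₅≢) g₅)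

xor-of-convex-has-no-three-runs : ∀ {f h} → Convex f → Convex h → ∀ {i₁ i₂ i₃ i₄ i₅} →
  i₁ ≤ i₂ → i₂ ≤ i₃ → i₃ ≤ i₄ → i₄ ≤ i₅ →
  f i₁ xor h i₁ ≡ true → f i₂ xor h i₂ ≡ false → f i₃ xor h i₃ ≡ true →
  f i₄ xor h i₄ ≡ false → f i₅ xor h i₅ ≡ true → ⊥
xor-of-convex-has-no-three-runs {f} {h} f-convex h-convex {i₁} p₁₂ p₂₃ p₃₄ p₄₅ g₁ g₂ g₃ g₄ g₅
  with f i₁ ≟ true
... | yes f₁  = ConvexRuns.three-runs-from-f f-convex h-convex p₁₂ p₂₃ p₃₄ p₄₅ f₁ g₂ g₃ g₄ g₅
... | no f₁≢ =
  ConvexRuns.three-runs-from-f h-convex f-convex p₁₂ p₂₃ p₃₄ p₄₅ h₁ (swap g₂) (swap g₃) (swap g₄) (swap g₅)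
  where
    swap : ∀ {j b} → f j xor h j ≡ b → h j xor f j ≡ b
    swap {j} = trans (xor-comm (h j) (f j))
    h₁ : h i₁ ≡ true
    h₁ = trans (xor-solveʳ (f i₁) g₁) (cong (_xor true) (¬-not f₁≢))

abstract
  inRange : ℕ → ℕ → ℕ → Bool
  inRange s t j = (s ≤ᵇ j) ∧ (j <ᵇ t)

  inRange⁺ : ∀ {s t j} → s ≤ j → j < t → inRange s t j ≡ true
  inRange⁺ s≤j j<t rewrite T⇒≡true (≤⇒≤ᵇ s≤j) | T⇒≡true (<⇒<ᵇ j<t) = refl

  inRange⁻ : ∀ {s t j} → inRange s t j ≡ true → s ≤ j × j < t
  inRange⁻ {s} {t} {j} e with s ≤ᵇ j in s≤ᵇj | j <ᵇ t in j<ᵇt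
  ... | true  | true = ≤ᵇ⇒≤ s j (≡true⇒T s≤ᵇj) , <ᵇ⇒< j t (≡true⇒T j<ᵇt)
  inRange⁻ () | true  | false
  inRange⁻ () | false | _

module _ {s t : ℕ} where

  inRange-< : ∀ {j} → j < s → inRange s t j ≡ false
  inRange-< j<s = ¬-not λ e → <⇒≱ j<s (proj₁ (inRange⁻ e))

  inRange-≥ : ∀ {j} → t ≤ j → inRange s t j ≡ false
  inRange-≥ t≤j = ¬-not λ e → <⇒≱ (proj₂ (inRange⁻ e)) t≤j

  inRange-convex : Convex (inRange s t)
  inRange-convex i≤j j≤l ei el = inRange⁺ (≤-trans (proj₁ (inRange⁻ ei)) i≤j) (≤-<-trans j≤l (proj₂ (inRange⁻ el)))

private
  start-differs : ∀ {s t s′ t′} → s < s′ → s < t → inRange s t s xor inRange s′ t′ s ≡ true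
  start-differs {s} {t} {s′} {t′} s<s′ s<t = cong₂ _xor_ (inRange⁺ {s} {t} ≤-refl s<t) (inRange-< {s′} {t′} s<s′)

  end-differs : ∀ {s t t′} → s ≤ t → t < t′ → inRange s t t xor inRange s t′ t ≡ true
  end-differs {s} {t} {t′} s≤t t<t′ = cong₂ _xor_ (inRange-≥ {s} {t} ≤-refl) (inRange⁺ {s} {t′} s≤t t<t′)

inRange-symdiff-witness : ∀ {s t s′ t′ b} → s < t → s′ < t′ → t ≤ b → t′ ≤ b → ¬ (s ≡ s′ × t ≡ t′) →
  ∃ λ j → j < b × inRange s t j xor inRange s′ t′ j ≡ true
inRange-symdiff-witness {s} {t} {s′} {t′} s<t s′<t′ t≤b t′≤b differ with <-cmp s s′
... | tri< s<s′ _ _ = s , <-≤-trans s<t t≤b , start-differs {t′ = t′} s<s′ s<t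
... | tri> _ _ s′<s =
  s′ , <-≤-trans s′<t′ t′≤b , trans (xor-comm (inRange s t s′) _) (start-differs {t′ = t} s′<s s′<t′)
... | tri≈ _ refl _ with <-cmp t t′
...   | tri< t<t′ _ _ = t , <-≤-trans t<t′ t′≤b , end-differs {t′ = t′} (<⇒≤ s<t) t<t′
...   | tri> _ _ t′<t =
  t′ , <-≤-trans t′<t t≤b , trans (xor-comm (inRange s t t′) _) (end-differs (<⇒≤ s′<t′) t′<t)
...   | tri≈ _ refl _ = ⊥-elim (differ (refl , refl))

module _ {A : Set} (p : A → Bool) where

  inRange-rank : ∀ xs {m a b w} → xs ‼ m ≡ just w → p w ≡ true →
                 inRange (rank p xs a) (rank p xs b) (rank p xs m) ≡ inRange a b m
  inRange-rank xs {m} {a} {b} e pw with a ≤? m | m <? b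
  ... | no a≰m  | _       = trans (inRange-< (rank-strict p xs e pw (≰⇒> a≰m))) (sym (inRange-< (≰⇒> a≰m)))
  ... | yes a≤m | yes m<b = trans (inRange⁺ (rank-mono p xs a≤m) (rank-strict p xs e pw m<b)) (sym (inRange⁺ a≤m m<b))
  ... | yes _   | no m≮b  = trans (inRange-≥ (rank-mono p xs (≮⇒≥ m≮b))) (sym (inRange-≥ (≮⇒≥ m≮b)))

module LeafIntervals (k : ℕ) where

  Periodic : (ℕ → Bool) → Set
  Periodic g = ∀ (i : Fin k) → g (k + toℕ i) ≡ g (toℕ i) × g (k + (k + toℕ i)) ≡ g (toℕ i)

  module _ {g : ℕ → Bool} (periodic : Periodic g) where

    private
      period₁ : ∀ {i} → i < k → g (k + i) ≡ g i
      period₁ i<k with proj₁ (periodic (fromℕ< i<k))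
      ... | e rewrite toℕ-fromℕ< i<k = e

      period₂ : ∀ {i} → i < k → g (k + (k + i)) ≡ g i
      period₂ i<k with proj₂ (periodic (fromℕ< i<k))
      ... | e rewrite toℕ-fromℕ< i<k = e

    least-<period : ∀ {m} → m < k + (k + k) → Least g m → m < k
    least-<period {m} m<3k (gm , below) with m <? k
    ... | yes m<k = m<k
    ... | no m≮k with m≤n⇒∃[o]m+o≡n (≮⇒≥ m≮k)
    ...   | j , refl with j <? k
    ...     | yes j<k = ⊥-elim (true≢false (trans (sym gm)
                          (trans (period₁ j<k) (below j (m<n+m j (≤-<-trans z≤n j<k))))))
    ...     | no j≮k with m≤n⇒∃[o]m+o≡n (≮⇒≥ j≮k)
    ...       | i , refl = ⊥-elim (true≢false (trans (sym gm) (trans (period₂ i<k) (below i i<m))))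
      where
        i<k : i < k
        i<k = +-cancelˡ-< k i k (+-cancelˡ-< k (k + i) (k + k) m<3k)
        i<m : i < k + (k + i)
        i<m = <-≤-trans (m<n+m i (≤-<-trans z≤n i<k)) (m≤n+m (k + i) k)

    -- Periodicity copies the least true point m < k to k + m and 2k + m, and the false point 0 to k and 2k.
    periodic-alternation : g 0 ≡ false → ∀ {j} → j < k + (k + k) → g j ≡ true →
      ∃ λ m → m ≤ k × g m ≡ true × g k ≡ false × g (k + m) ≡ true
                    × g (k + k) ≡ false × g (k + (k + m)) ≡ true
    periodic-alternation g0 j<3k gj with least-true g gj
    ... | m , m≤j , gm , below = m , <⇒≤ m<k , gm , gk , trans (period₁ m<k) gm , g2k , trans (period₂ m<k) gm
      where
        m<k : m < k
        m<k = least-<period (≤-<-trans m≤j j<3k) (gm , below)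
        0<k : 0 < k
        0<k = ≤-<-trans z≤n m<k
        gk : g k ≡ false
        gk = trans (cong g (sym (+-identityʳ k))) (trans (period₁ 0<k) g0)
        g2k : g (k + k) ≡ false
        g2k = trans (cong (λ x → g (k + x)) (sym (+-identityʳ k))) (trans (period₂ 0<k) g0)

  -- With a_i, b_i, c_i the leaves of index i, k + i, 2k + i, splitsAB s t i says that exactly one
  -- of a_i, b_i has its index in [s, t).
  splitsAB splitsAC : ℕ → ℕ → Fin k → Bool
  splitsAB s t i = inRange s t (toℕ i) xor inRange s t (k + toℕ i)
  splitsAC s t i = inRange s t (toℕ i) xor inRange s t (k + (k + toℕ i))

  -- Otherwise inRange s t is periodic and takes the values true, false, true at m ≤ k ≤ k + m.
  some-split : ∀ {s t} → 1 ≤ s → s < t → t ≤ k + (k + k) →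
    ∃ λ i → splitsAB s t i ≡ true ⊎ splitsAC s t i ≡ true
  some-split {s} {t} 1≤s s<t t≤3k with any? (λ i → (splitsAB s t i ≟ true) ⊎-dec (splitsAC s t i ≟ true))
  ... | yes split = split
  ... | no no-split
    with periodic-alternation {inRange s t} periodic (inRange-< {s} {t} 1≤s) (<-≤-trans s<t t≤3k) (inRange⁺ ≤-refl s<t)
    where
      periodic : Periodic (inRange s t)
      periodic i = xor≡false⇒≡ _ (¬-not λ e → no-split (i , inj₁ e))
                 , xor≡false⇒≡ _ (¬-not λ e → no-split (i , inj₂ e))
  ... | m , m≤k , gm , gk , gkm , _ = ⊥-elim (true≢false (trans (sym (inRange-convex {s} {t} m≤k (m≤m+n k m) gm gkm)) gk))

  -- Otherwise the symmetric difference of the two intervals is periodic, so it alternates five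
  -- times, while the symmetric difference of two intervals consists of at most two runs.
  splits-injective : ∀ {s t s′ t′} → 1 ≤ s → s < t → t ≤ k + (k + k) → 1 ≤ s′ → s′ < t′ → t′ ≤ k + (k + k) →
    (∀ i → splitsAB s t i ≡ splitsAB s′ t′ i) → (∀ i → splitsAC s t i ≡ splitsAC s′ t′ i) →
    s ≡ s′ × t ≡ t′
  splits-injective {s} {t} {s′} {t′} 1≤s s<t t≤3k 1≤s′ s′<t′ t′≤3k sameAB sameAC
    with (s ≟ℕ s′) ×-dec (t ≟ℕ t′)
  ... | yes same = same
  ... | no differ with inRange-symdiff-witness s<t s′<t′ t≤3k t′≤3k differ
  ...   | j , j<3k , gj with periodic-alternation {g} periodic g0 j<3k gj
    where
      g : ℕ → Bool
      g j = inRange s t j xor inRange s′ t′ j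
      periodic : Periodic g
      periodic i = sym (xor-interchange (I i′) (I (k + i′)) (I′ i′) (I′ (k + i′)) (sameAB i))
                 , sym (xor-interchange (I i′) (I (k + (k + i′))) (I′ i′) (I′ (k + (k + i′))) (sameAC i))
        where I I′ : ℕ → Bool
              I  = inRange s t
              I′ = inRange s′ t′
              i′ : ℕ
              i′ = toℕ i
      g0 : g 0 ≡ false
      g0 = cong₂ _xor_ (inRange-< {s} {t} 1≤s) (inRange-< {s′} {t′} 1≤s′)
  ...     | m , m≤k , g₁ , g₂ , g₃ , g₄ , g₅ = ⊥-elim
    (xor-of-convex-has-no-three-runs (inRange-convex {s} {t}) (inRange-convex {s′} {t′})
      m≤k (m≤m+n k m) (+-monoʳ-≤ k m≤k) (+-monoʳ-≤ k (m≤m+n k m)) g₁ g₂ g₃ g₄ g₅)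

-- Walks, paths and edges

star-invariant : ∀ {A : Set} {R : A → A → Set} (P : A → Set) → (∀ {x y} → R x y → P x → P y) →
                 ∀ {x y} → Star R x y → P x → P y
star-invariant P step ε        px = px
star-invariant P step (r ◅ rs) px = star-invariant P step rs (step r px)

module _ {n : ℕ} (R : Fin n → Fin n → Set) where

  open import Data.List.Membership.DecPropositional (_≟F_ {n}) using (_∈?_)

  SimpleWalk : Fin n → Fin n → List (Fin n) → Set
  SimpleWalk x y xs = Linked R (x ∷ xs) × Unique (x ∷ xs) × last (x ∷ xs) ≡ just y

  private
    suffix-from : ∀ {x y} ys → x ∈ ys → Linked R ys → Unique ys → last ys ≡ just y → ∃ (SimpleWalk x y)
    suffix-from (z ∷ ws)      (here refl) linked       unique       e = ws , linked , unique , e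
    suffix-from (z ∷ z′ ∷ zs) (there x∈)  (_ ∷ linked) (_ ∷ unique) e = suffix-from (z′ ∷ zs) x∈ linked unique e

  star⇒simpleWalk : ∀ {x y} → Star R x y → ∃ (SimpleWalk x y)
  star⇒simpleWalk ε = [] , [-] , [] ∷ [] , refl
  star⇒simpleWalk {x} (_◅_ {j = z} r rs) with star⇒simpleWalk rs
  ... | ws , linked , unique , e with x ∈? (z ∷ ws)
  ...   | yes x∈ = suffix-from (z ∷ ws) x∈ linked unique e
  ...   | no x∉  = z ∷ ws , r ∷ linked , ¬Any⇒All¬ (z ∷ ws) x∉ ∷ unique , e

module _ {n : ℕ} (G : Graph n) where

  Adj-sym : ∀ {u v} → Adj G u v → Adj G v u
  Adj-sym {u} {v} u~v = trans (Graph.sym G v u) u~v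

  Adj-irrefl : ∀ {v} → ¬ Adj G v v
  Adj-irrefl {v} v~v = true≢false (trans (sym v~v) (Graph.irrefl G v))

  neighbours : Fin n → List (Fin n)
  neighbours w = filterᵇ (adj G w) (vertices G)

  private
    neighbours-unique : ∀ w → Unique (neighbours w)
    neighbours-unique w = filter⁺ (T? ∘ adj G w) (tabulate⁺ id)

    ∈neighbours⇒Adj : ∀ {w z} → z ∈ neighbours w → Adj G w z
    ∈neighbours⇒Adj {w} z∈ = T⇒≡true (proj₂ (∈-filter⁻ (T? ∘ adj G w) {xs = vertices G} z∈))

    Adj⇒∈neighbours : ∀ {w z} → Adj G w z → z ∈ neighbours w
    Adj⇒∈neighbours {w} {z} w~z = ∈-filter⁺ (T? ∘ adj G w) (∈-tabulate⁺ z) (≡true⇒T w~z)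

  ThreeNeighbours : Fin n → Set
  ThreeNeighbours w = ∃₂ λ z₁ z₂ → ∃ λ z₃ →
    Adj G w z₁ × Adj G w z₂ × Adj G w z₃ × z₁ ≢ z₂ × z₁ ≢ z₃ × z₂ ≢ z₃

  three-neighbours : (∀ v → deg G v ≢ 2) → ∀ {w u} → Adj G w u → isLeafᵇ G w ≡ false → ThreeNeighbours w
  three-neighbours no-deg-2 {w} {u} w~u non-leaf = count (neighbours w) refl (neighbours-unique w) (Adj⇒∈neighbours w~u)
    where
      count : ∀ L → L ≡ neighbours w → Unique L → u ∈ L → ThreeNeighbours w
      count (z₁ ∷ []) e _ _ = ⊥-elim (true≢false (trans (cong (λ L → length L ≡ᵇ 1) e) non-leaf))
      count (z₁ ∷ z₂ ∷ []) e _ _ = ⊥-elim (no-deg-2 w (cong length (sym e)))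
      count L@(z₁ ∷ z₂ ∷ z₃ ∷ _) e ((z₁≢z₂ ∷ z₁≢z₃ ∷ _) ∷ (z₂≢z₃ ∷ _) ∷ _) _ =
        z₁ , z₂ , z₃ , neighbour (here refl) , neighbour (there (here refl)) ,
        neighbour (there (there (here refl))) , z₁≢z₂ , z₁≢z₃ , z₂≢z₃
        where neighbour : ∀ {z} → z ∈ L → Adj G w z
              neighbour z∈ = ∈neighbours⇒Adj (subst (_ ∈_) e z∈)

module _ {n : ℕ} (G : Graph n) {u v : Fin n} {L : List (Fin n)} (path : IsPath G u v L) where

  IsPath-head : head L ≡ just u
  IsPath-head = proj₁ (proj₂ (proj₂ path))

  IsPath-last : last L ≡ just v
  IsPath-last = proj₂ (proj₂ (proj₂ path))

module _ {n : ℕ} where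

  SameEdge : Fin n → Fin n → Fin n → Fin n → Set
  SameEdge a b c d = (c ≡ a × d ≡ b) ⊎ (c ≡ b × d ≡ a)

  sameEdge? : ∀ a b c d → Dec (SameEdge a b c d)
  sameEdge? a b c d = ((c ≟F a) ×-dec (d ≟F b)) ⊎-dec ((c ≟F b) ×-dec (d ≟F a))

  SameEdge-flip : ∀ {a b c d} → SameEdge a b c d → SameEdge b a c d
  SameEdge-flip (inj₁ e) = inj₂ e
  SameEdge-flip (inj₂ e) = inj₁ e

  module _ {G : Graph n} where

    EdgeIn-swap : ∀ {x y L} → EdgeIn G x y L → EdgeIn G y x L
    EdgeIn-swap (inj₁ c) = inj₂ c
    EdgeIn-swap (inj₂ c) = inj₁ c

    EdgeIn-here : ∀ {a b c d r} → SameEdge a b c d → EdgeIn G a b (c ∷ d ∷ r)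
    EdgeIn-here (inj₁ (refl , refl)) = inj₁ here
    EdgeIn-here (inj₂ (refl , refl)) = inj₂ here

    EdgeIn-there : ∀ {a b c L} → EdgeIn G a b L → EdgeIn G a b (c ∷ L)
    EdgeIn-there (inj₁ c) = inj₁ (there c)
    EdgeIn-there (inj₂ c) = inj₂ (there c)

    EdgeIn-tail : ∀ {a b c d r} → ¬ SameEdge a b c d → EdgeIn G a b (c ∷ d ∷ r) → EdgeIn G a b (d ∷ r)
    EdgeIn-tail ¬ab (inj₁ here)      = ⊥-elim (¬ab (inj₁ (refl , refl)))
    EdgeIn-tail ¬ab (inj₂ here)      = ⊥-elim (¬ab (inj₂ (refl , refl)))
    EdgeIn-tail ¬ab (inj₁ (there c)) = inj₁ c
    EdgeIn-tail ¬ab (inj₂ (there c)) = inj₂ c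

    EdgeIn⇒∈ : ∀ {a b L} → EdgeIn G a b L → a ∈ L × b ∈ L
    EdgeIn⇒∈ (inj₁ c) = consec⇒∈ c
      where consec⇒∈ : ∀ {x y L} → ConsecIn G x y L → x ∈ L × y ∈ L
            consec⇒∈ here      = here refl , there (here refl)
            consec⇒∈ (there c) = let x∈ , y∈ = consec⇒∈ c in there x∈ , there y∈
    EdgeIn⇒∈ (inj₂ c) = let b∈ , a∈ = EdgeIn⇒∈ (inj₁ c) in a∈ , b∈

    SameEdge-endpoint∉ : ∀ {a b w d L} → SameEdge a b w d → w ∉ L → ¬ EdgeIn G a b L
    SameEdge-endpoint∉ (inj₁ (refl , _)) w∉ e = w∉ (proj₁ (EdgeIn⇒∈ e))
    SameEdge-endpoint∉ (inj₂ (refl , _)) w∉ e = w∉ (proj₂ (EdgeIn⇒∈ e))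

-- Cutting an edge of a tree

module EdgeCut {n : ℕ} (G : Graph n) (connected : Connected G) (acyclic : Acyclic G)
               (a b : Fin n) (a~b : Adj G a b) where

  OtherEdge : Fin n → Fin n → Set
  OtherEdge c d = Adj G c d × ¬ SameEdge a b c d

  OtherEdge-sym : ∀ {c d} → OtherEdge c d → OtherEdge d c
  OtherEdge-sym (c~d , ¬ab) = Adj-sym G c~d , λ { (inj₁ (d≡a , c≡b)) → ¬ab (inj₂ (c≡b , d≡a))
                                                ; (inj₂ (d≡b , c≡a)) → ¬ab (inj₁ (c≡a , d≡b)) }

  -- A simple a–b walk avoiding the edge ab closes up with ab into a cycle.
  a↮b : ¬ Star OtherEdge a b
  a↮b walk with star⇒simpleWalk OtherEdge walk
  ... | []           , _      , _      , e = Adj-irrefl G (subst (Adj G a) (sym (just-injective e)) a~b)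
  ... | c ∷ []       , r ∷ _  , _      , e = proj₂ r (inj₁ (refl , just-injective e))
  ... | c ∷ d ∷ rest , linked , unique , e = acyclic (a ∷ c ∷ d ∷ rest)
        (a , c , d , rest , refl , Linked-map proj₁ linked , unique ,
         λ w e′ → subst (λ z → Adj G z a) (just-injective (trans (sym e) e′)) (Adj-sym G a~b))

  private
    walk-to-a : ∀ w ws → Linked (Adj G) (w ∷ ws) → last (w ∷ ws) ≡ just a →
                Star OtherEdge w a ⊎ Star OtherEdge w b
    walk-to-a w []       _               e with just-injective e
    ... | refl = inj₁ ε
    walk-to-a w (d ∷ ds) (w~d ∷ linked) e with sameEdge? a b w d
    ... | yes (inj₁ (refl , _)) = inj₁ ε
    ... | yes (inj₂ (refl , _)) = inj₂ ε
    ... | no ¬ab = ⊎-map ((w~d , ¬ab) ◅_) ((w~d , ¬ab) ◅_) (walk-to-a d ds linked e)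

  component : ∀ w → Star OtherEdge a w ⊎ Star OtherEdge b w
  component w with connected w a
  ... | w′ ∷ ws , linked , _ , refl , e =
    ⊎-map (reverse OtherEdge-sym) (reverse OtherEdge-sym) (walk-to-a w′ ws linked e)

  abstract
    side : Fin n → Bool
    side w = [ (λ _ → false) , (λ _ → true) ]′ (component w)

    side-true⇒ : ∀ {w} → side w ≡ true → Star OtherEdge b w
    side-true⇒ {w} with component w
    ... | inj₂ b⇝w = λ _ → b⇝w

    side-false⇒ : ∀ {w} → side w ≡ false → Star OtherEdge a w
    side-false⇒ {w} with component w
    ... | inj₁ a⇝w = λ _ → a⇝w

    ⇒side-true : ∀ {w} → Star OtherEdge b w → side w ≡ true
    ⇒side-true {w} b⇝w with component w
    ... | inj₁ a⇝w = ⊥-elim (a↮b (a⇝w ◅◅ reverse OtherEdge-sym b⇝w))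
    ... | inj₂ _   = refl

    ⇒side-false : ∀ {w} → Star OtherEdge a w → side w ≡ false
    ⇒side-false {w} a⇝w with component w
    ... | inj₁ _   = refl
    ... | inj₂ b⇝w = ⊥-elim (a↮b (a⇝w ◅◅ reverse OtherEdge-sym b⇝w))

  side-a : side a ≡ false
  side-a = ⇒side-false ε

  side-b : side b ≡ true
  side-b = ⇒side-true ε

  side-step : ∀ {c d} → OtherEdge c d → side c ≡ side d
  side-step {c} {d} r with side c in eq
  ... | true  = sym (⇒side-true (side-true⇒ eq ◅◅ (r ◅ ε)))
  ... | false = sym (⇒side-false (side-false⇒ eq ◅◅ (r ◅ ε)))

  side-across : ∀ {c d} → SameEdge a b c d → side c ≡ not (side d)
  side-across (inj₁ (refl , refl)) = trans side-a (cong not (sym side-b))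
  side-across (inj₂ (refl , refl)) = trans side-b (cong not (sym side-a))

  side-cut : ∀ {c d} → Adj G c d → side c ≡ true → side d ≡ false → c ≡ b × d ≡ a
  side-cut {c} {d} c~d sc sd with sameEdge? a b c d
  ... | yes (inj₂ cd≡ba)       = cd≡ba
  ... | yes (inj₁ (refl , _)) = ⊥-elim (true≢false (trans (sym sc) side-a))
  ... | no ¬ab                = ⊥-elim (true≢false (trans (sym sc) (trans (side-step (c~d , ¬ab)) sd)))

  private
    crosses⇔ : ∀ w ws {v} → Linked (Adj G) (w ∷ ws) → Unique (w ∷ ws) → last (w ∷ ws) ≡ just v →
               EdgeIn G a b (w ∷ ws) ⇔ (side w xor side v ≡ true)
    crosses⇔ w [] _ _ e with just-injective e
    ... | refl = mk⇔ (λ { (inj₁ (there ())) ; (inj₂ (there ())) })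
                     (λ s → ⊥-elim (true≢false (trans (sym s) (xor-same (side w)))))
    crosses⇔ w (d ∷ ds) {v} (w~d ∷ linked) (w∉ ∷ unique) e with sameEdge? a b w d
    ... | yes ab = mk⇔ (λ _ → crossed) (λ _ → EdgeIn-here ab)
      where
        crossed : side w xor side v ≡ true
        crossed = begin
          side w xor side v             ≡⟨ cong₂ _xor_ (side-across ab) (xor≡false⇒≡ (side d) (¬-not not-again)) ⟩
          not (side d) xor side d       ≡⟨ xor-inverseˡ (side d) ⟩
          true                          ∎
          where
            open ≡-Reasoning
            not-again : side d xor side v ≢ true
            not-again s = SameEdge-endpoint∉ ab (All¬⇒¬Any w∉) (Equivalence.from (crosses⇔ d ds linked unique e) s)
    ... | no ¬ab rewrite side-step (w~d , ¬ab) =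
      mk⇔ (λ e′ → Equivalence.to ih (EdgeIn-tail ¬ab e′)) (λ s → EdgeIn-there (Equivalence.from ih s))
      where ih : EdgeIn G a b (d ∷ ds) ⇔ (side d xor side v ≡ true)
            ih = crosses⇔ d ds linked unique e

  path-crosses⇔ : ∀ {u v L} → IsPath G u v L → EdgeIn G a b L ⇔ (side u xor side v ≡ true)
  path-crosses⇔ {L = w ∷ ws} (linked , unique , refl , e) = crosses⇔ w ws linked unique e

-- Depth-first search order

module DFSPositions {n : ℕ} (G : Graph n) {r : Fin n} {ord : List (Fin n)} (isDFS : IsDFSOrder G r ord) where

  private
    unique : Unique ord
    unique = proj₁ (proj₂ isDFS)

    complete : ∀ v → v ∈ ord
    complete = proj₁ (proj₂ (proj₂ isDFS))

  N : ℕ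
  N = length ord

  abstract
    pos : Fin n → ℕ
    pos w = proj₁ (∈⇒‼ (complete w))

    ord-at-pos : ∀ w → ord ‼ pos w ≡ just w
    ord-at-pos w = proj₂ (∈⇒‼ (complete w))

  pos-unique : ∀ {m w} → ord ‼ m ≡ just w → m ≡ pos w
  pos-unique {m} {w} e = Unique⇒‼-injective unique m (pos w) e (ord-at-pos w)

  pos-injective : ∀ {v w} → pos v ≡ pos w → v ≡ w
  pos-injective {v} {w} e = just-injective (trans (sym (ord-at-pos v)) (trans (cong (ord ‼_) e) (ord-at-pos w)))

  pos<N : ∀ w → pos w < N
  pos<N w = ‼⇒<length ord (pos w) (ord-at-pos w)

  vertex-at : ∀ {i} → i < N → ∃ λ w → pos w ≡ i
  vertex-at {i} i<N = let w , e = <length⇒‼ ord i i<N in w , sym (pos-unique e)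

  pos-root : pos r ≡ 0
  pos-root = sym (pos-unique (‼-head ord (proj₁ isDFS)))
    where ‼-head : ∀ xs → head xs ≡ just r → xs ‼ 0 ≡ just r
          ‼-head (x ∷ xs) e = e

  abstract
    discovered-from : ∀ v → 0 < pos v → ∃ λ u → pos u < pos v × Adj G u v ×
      (∀ w → pos u < pos w → pos w < pos v → ∀ z → Adj G w z → pos z < pos v)
    discovered-from v 0<pv with proj₂ (proj₂ (proj₂ isDFS)) (take (pos v) ord) v (drop (suc (pos v)) ord)
                                        (‼-split ord (pos v) (ord-at-pos v)) (take-nonempty 0<pv (ord-at-pos v))
      where take-nonempty : ∀ {m xs} → 0 < m → xs ‼ m ≡ just v → take m xs ≢ []
            take-nonempty {suc m} {x ∷ xs} _ _ ()
    ... | pre₁ , u , pre₂ , split , u~v , finished = u , pu<pv , u~v , all-finished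
      where
        before : List (Fin n)
        before = take (pos v) ord
        pos-in-before : ∀ {i w} → before ‼ i ≡ just w → i ≡ pos w × pos w < pos v
        pos-in-before {i} e with ‼-take⁻ ord (pos v) i e
        ... | i<pv , e′ rewrite pos-unique e′ = refl , i<pv
        u-index : before ‼ length pre₁ ≡ just u
        u-index = trans (cong (_‼ length pre₁) split)
                        (trans (cong ((pre₁ ++ u ∷ pre₂) ‼_) (sym (+-identityʳ (length pre₁))))
                               (‼-++ʳ pre₁ (u ∷ pre₂) 0))
        pu<pv : pos u < pos v
        pu<pv = proj₂ (pos-in-before u-index)
        all-finished : ∀ w → pos u < pos w → pos w < pos v → ∀ z → Adj G w z → pos z < pos v
        all-finished w pu<pw pw<pv z w~z with m≤n⇒∃[o]m+o≡n (subst (_< pos w) (sym (proj₁ (pos-in-before u-index))) pu<pw)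
        ... | j , e = proj₂ (pos-in-before (proj₂ (∈⇒‼ z∈before)))
          where
            w-in-pre₂ : pre₂ ‼ j ≡ just w
            w-in-pre₂ = begin
              pre₂ ‼ j                                ≡⟨ sym (‼-++ʳ pre₁ (u ∷ pre₂) (suc j)) ⟩
              (pre₁ ++ u ∷ pre₂) ‼ (length pre₁ + suc j) ≡⟨ cong ((pre₁ ++ u ∷ pre₂) ‼_) (trans (+-suc (length pre₁) j) e) ⟩
              (pre₁ ++ u ∷ pre₂) ‼ pos w              ≡⟨ cong (_‼ pos w) (sym split) ⟩
              before ‼ pos w                          ≡⟨ ‼-take⁺ ord (pos v) (pos w) pw<pv (ord-at-pos w) ⟩
              just w                                  ∎
              where open ≡-Reasoning
            z∈before : z ∈ before
            z∈before = All.lookup finished (‼⇒∈ pre₂ j w-in-pre₂) z w~z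

module DFSTree {n : ℕ} (G : Graph n) (connected : Connected G) (acyclic : Acyclic G)
               {r : Fin n} {ord : List (Fin n)} (isDFS : IsDFSOrder G r ord) where

  open DFSPositions G isDFS public

  pos≡0⇒root : ∀ {w} → pos w ≡ 0 → w ≡ r
  pos≡0⇒root e = pos-injective (trans e (sym pos-root))

  -- The component of b after cutting the edge ab, when the root lies on the side of a.
  module Below (a b : Fin n) (a~b : Adj G a b) (root-side : EdgeCut.side G connected acyclic a b a~b r ≡ false) where

    open EdgeCut G connected acyclic a b a~b public

    private
      nonroot : ∀ {w} → side w ≡ true → 0 < pos w
      nonroot {w} sw with pos w in e
      ... | suc _ = s≤s z≤n
      ... | zero  = ⊥-elim (true≢false (trans (sym sw) (trans (cong side (pos≡0⇒root e)) root-side)))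

      -- Along DFS parents, a vertex on b's side reaches b without leaving it.
      b-first : ∀ m w → pos w < m → side w ≡ true → pos b ≤ pos w
      b-first (suc m) w pw<1+m sw with w ≟F b
      ... | yes refl = ≤-refl
      ... | no w≢b with discovered-from w (nonroot sw)
      ...   | u , pu<pw , u~w , _ with side u in su
      ...     | true  = ≤-trans (b-first m u (≤-trans pu<pw (≤-pred pw<1+m)) su) (<⇒≤ pu<pw)
      ...     | false = ⊥-elim (w≢b (proj₁ (side-cut (Adj-sym G u~w) sw su)))

    side⇒b≤ : ∀ {w} → side w ≡ true → pos b ≤ pos w
    side⇒b≤ {w} = b-first (suc (pos w)) w ≤-refl

    a<b : pos a < pos b
    a<b with discovered-from b (nonroot side-b)
    ... | u , pu<pb , u~b , _ with side u in su
    ... | true  = ⊥-elim (<⇒≱ pu<pb (side⇒b≤ su))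
    ... | false with side-cut (Adj-sym G u~b) side-b su
    ...   | _ , refl = pu<pb

    private
      side-at : ℕ → Bool
      side-at i = maybe side false (ord ‼ i)

      side-at-pos : ∀ w → side-at (pos w) ≡ side w
      side-at-pos w = cong (maybe side false) (ord-at-pos w)

      leaves-component : ℕ → Bool
      leaves-component i = (pos b <ᵇ i) ∧ not (side-at i)

    abstract
      private
        end-search : ∃ λ l → l ≤ N × Least leaves-component l
        end-search = least-true leaves-component {N}
          (cong₂ _∧_ (T⇒≡true (<⇒<ᵇ (pos<N b))) (cong (not ∘ maybe side false) (≥length⇒‼ ord N ≤-refl)))

      end : ℕ
      end = proj₁ end-search

      end≤N : end ≤ N
      end≤N = proj₁ (proj₂ end-search)

      private
        leaves-at-end : leaves-component end ≡ true
        leaves-at-end = proj₁ (proj₂ (proj₂ end-search))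

        stays-before-end : ∀ {j} → j < end → leaves-component j ≡ false
        stays-before-end {j} = proj₂ (proj₂ (proj₂ end-search)) j

    b<end : pos b < end
    b<end = <ᵇ⇒< (pos b) end (≡true⇒T (proj₁ (∧-true⁻ leaves-at-end)))

    inside⇒side : ∀ w → pos b ≤ pos w → pos w < end → side w ≡ true
    inside⇒side w pb≤pw pw<end with m≤n⇒m<n∨m≡n pb≤pw
    ... | inj₂ pb≡pw = subst (λ x → side x ≡ true) (pos-injective pb≡pw) side-b
    ... | inj₁ pb<pw with stays-before-end pw<end
    ...   | stays rewrite T⇒≡true (<⇒<ᵇ pb<pw) | side-at-pos w = not-injective stays

    side⇒<end : ∀ {w} → side w ≡ true → pos w < end
    side⇒<end {w} sw with N ≤? end
    ... | yes N≤end = <-≤-trans (pos<N w) N≤end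
    ... | no  N≰end with vertex-at (≰⇒> N≰end)
    ...   | z , pz≡end = subst (pos w <_) pz≡end
                           (proj₂ (star-invariant Before-z step (side-true⇒ sw) (side-b , pb<pz)))
      where
        pb<pz : pos b < pos z
        pb<pz = subst (pos b <_) (sym pz≡end) b<end
        sz : side z ≡ false
        sz = trans (sym (side-at-pos z))
                   (trans (cong side-at pz≡end) (not-injective (proj₂ (∧-true⁻ leaves-at-end))))
        Before-z : Fin n → Set
        Before-z x = side x ≡ true × pos x < pos z
        step : ∀ {x y} → OtherEdge x y → Before-z x → Before-z y
        step {x} {y} x-y (sx , px<pz) with discovered-from z (≤-<-trans z≤n pb<pz)
        ... | u , pu<pz , u~z , finished = trans (sym (side-step x-y)) sx , finished x pu<px px<pz y (proj₁ x-y)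
          where
            su : side u ≡ false
            su with side u in su
            ... | false = refl
            ... | true  = ⊥-elim (<⇒≱ (<-trans a<b b<end)
                            (≤-reflexive (trans (sym pz≡end) (cong pos (proj₂ (side-cut u~z su sz))))))
            pu<px : pos u < pos x
            pu<px with pos u <? pos b
            ... | yes pu<pb = <-≤-trans pu<pb (side⇒b≤ sx)
            ... | no  pu≮pb = ⊥-elim (true≢false
                                (trans (sym (inside⇒side u (≮⇒≥ pu≮pb) (subst (pos u <_) pz≡end pu<pz))) su))

    side≡inRange : ∀ w → side w ≡ inRange (pos b) end (pos w)
    side≡inRange w with side w in sw
    ... | true  = sym (inRange⁺ (side⇒b≤ sw) (side⇒<end sw))
    ... | false = sym (¬-not λ i → true≢false (trans (sym (uncurry (inside⇒side w) (inRange⁻ i))) sw))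

  root-outside : ∀ {x y} (x~y : Adj G x y) → pos x < pos y → EdgeCut.side G connected acyclic x y x~y r ≡ false
  root-outside {x} {y} x~y px<py with EdgeCut.side G connected acyclic x y x~y r in e
  ... | false = refl
  ... | true  = ⊥-elim (<⇒≱ px<py (<⇒≤ (Below.a<b y x (Adj-sym G x~y) root-side-yx)))
    where
      flip : ∀ {c d} → EdgeCut.OtherEdge G connected acyclic x y x~y c d →
                       EdgeCut.OtherEdge G connected acyclic y x (Adj-sym G x~y) c d
      flip (c~d , ¬xy) = c~d , ¬xy ∘ SameEdge-flip
      root-side-yx : EdgeCut.side G connected acyclic y x (Adj-sym G x~y) r ≡ false
      root-side-yx = EdgeCut.⇒side-false G connected acyclic y x (Adj-sym G x~y)
                       (Star-map flip (EdgeCut.side-true⇒ G connected acyclic x y x~y e))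

  record TreeEdge : Set where
    constructor treeEdge
    field
      parent child : Fin n
      parent~child : Adj G parent child
      parent-first : pos parent < pos child

  module Subtree (E : TreeEdge) where
    open TreeEdge E public
    open Below parent child parent~child (root-outside parent~child parent-first) public

    inside : Fin n → Bool
    inside w = inRange (pos child) end (pos w)

    inside-child : inside child ≡ true
    inside-child = inRange⁺ ≤-refl b<end

    inside⇒nonroot : ∀ {w} → inside w ≡ true → 0 < pos w
    inside⇒nonroot in-w = <-≤-trans (≤-<-trans z≤n parent-first) (proj₁ (inRange⁻ in-w))

    outside-before : ∀ {w} → pos w < pos child → inside w ≡ false
    outside-before = inRange-<

    outside-after : ∀ {w} → end ≤ pos w → inside w ≡ false
    outside-after = inRange-≥

    outside⇒after : ∀ {w} → inside w ≡ false → pos child ≤ pos w → end ≤ pos w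
    outside⇒after {w} out pb≤pw with end ≤? pos w
    ... | yes end≤pw = end≤pw
    ... | no  end≰pw = ⊥-elim (true≢false (trans (sym (inRange⁺ pb≤pw (≰⇒> end≰pw))) out))

    cut : ∀ {w z} → Adj G w z → inside w ≡ true → inside z ≡ false → w ≡ child × z ≡ parent
    cut {w} {z} w~z in-w out-z = side-cut w~z (trans (side≡inRange w) in-w) (trans (side≡inRange z) out-z)

  SameLeaves : TreeEdge → TreeEdge → Set
  SameLeaves E F = ∀ ℓ → isLeafᵇ G ℓ ≡ true → Subtree.inside E ℓ ≡ Subtree.inside F ℓ

  earlier-neighbour-unique : ∀ {w u₁ u₂} → Adj G u₁ w → Adj G u₂ w → pos u₁ < pos w → pos u₂ < pos w → u₁ ≡ u₂
  earlier-neighbour-unique {w} {u₁} {u₂} u₁~w u₂~w pu₁<pw pu₂<pw =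
    sym (proj₂ (cut (Adj-sym G u₂~w) inside-child (outside-before pu₂<pw)))
    where open Subtree (treeEdge u₁ w u₁~w pu₁<pw)

  data Orientation (x y : Fin n) (E : TreeEdge) : Set where
    forward  : TreeEdge.parent E ≡ x → TreeEdge.child E ≡ y → Orientation x y E
    backward : TreeEdge.parent E ≡ y → TreeEdge.child E ≡ x → Orientation x y E

  orient : ∀ {x y} → Adj G x y → Σ TreeEdge (Orientation x y)
  orient {x} {y} x~y with <-cmp (pos x) (pos y)
  ... | tri< px<py _ _ = treeEdge x y x~y px<py , forward refl refl
  ... | tri> _ _ py<px = treeEdge y x (Adj-sym G x~y) py<px , backward refl refl
  ... | tri≈ _ px≡py _ = ⊥-elim (Adj-irrefl G (subst (Adj G x) (sym (pos-injective px≡py)) x~y))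

  Orientation-EdgeIn : ∀ {x y E L} → Orientation x y E →
    EdgeIn G x y L ⇔ EdgeIn G (TreeEdge.parent E) (TreeEdge.child E) L
  Orientation-EdgeIn (forward refl refl)  = mk⇔ id id
  Orientation-EdgeIn (backward refl refl) = mk⇔ EdgeIn-swap EdgeIn-swap

  module _ (E F : TreeEdge) where
    private
      module E = Subtree E
      module F = Subtree F

    -- Otherwise the vertex z right after E's subtree lies in F's subtree, while its DFS parent lies
    -- before E.child, so the edge between them leaves F's subtree and must be F's own edge.
    subtrees-nested : pos E.child < pos F.child → pos F.child < E.end → F.end ≤ E.end
    subtrees-nested cE<cF cF<endE with F.end ≤? E.end
    ... | yes ok = ok
    ... | no endF≰endE = ⊥-elim (uncurry escape (vertex-at (<-≤-trans endE<endF F.end≤N)))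
      where
        endE<endF : E.end < F.end
        endE<endF = ≰⇒> endF≰endE
        escape : ∀ z → pos z ≡ E.end → ⊥
        escape z pz≡endE with discovered-from z (≤-<-trans z≤n (subst (pos F.child <_) (sym pz≡endE) cF<endE))
        ... | u , pu<pz , u~z , _ = <-irrefl pz≡endE (subst (_< E.end) (cong pos (sym z≡cF)) cF<endE)
          where
            out-E-z : E.inside z ≡ false
            out-E-z = E.outside-after (≤-reflexive (sym pz≡endE))
            in-F-z : F.inside z ≡ true
            in-F-z = inRange⁺ (<⇒≤ (subst (pos F.child <_) (sym pz≡endE) cF<endE))
                              (subst (_< F.end) (sym pz≡endE) endE<endF)
            out-E-u : E.inside u ≡ false
            out-E-u = ¬-not λ in-u → <-irrefl (cong pos (sym (proj₂ (E.cut u~z in-u out-E-z))))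
                        (<-trans E.parent-first (subst (pos E.child <_) (sym pz≡endE) E.b<end))
            pu<cE : pos u < pos E.child
            pu<cE with pos u <? pos E.child
            ... | yes pu<cE = pu<cE
            ... | no  pu≮cE = ⊥-elim (<⇒≱ (subst (pos u <_) pz≡endE pu<pz) (E.outside⇒after out-E-u (≮⇒≥ pu≮cE)))
            z≡cF : z ≡ F.child
            z≡cF = proj₁ (F.cut (Adj-sym G u~z) in-F-z (F.outside-before (<-trans pu<cE cE<cF)))

  private
    Blocked : Fin n → Fin n → Fin n → Set
    Blocked w t z = pos z < pos w ⊎ z ≡ t

    classify : ∀ {w z} t → Adj G w z → (pos w < pos z × z ≢ t) ⊎ Blocked w t z
    classify {w} {z} t w~z with z ≟F t | pos w <? pos z
    ... | yes z≡t | _         = inj₂ (inj₂ z≡t)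
    ... | no z≢t  | yes pw<pz = inj₁ (pw<pz , z≢t)
    ... | no _    | no pw≮pz  = inj₂ (inj₁ (≤∧≢⇒< (≮⇒≥ pw≮pz)
                                  λ pz≡pw → Adj-irrefl G (subst (Adj G w) (pos-injective pz≡pw) w~z)))

    earlier-neighbours-equal : ∀ {w z z′} → Adj G w z → Adj G w z′ → pos z < pos w → pos z′ < pos w → z ≡ z′
    earlier-neighbours-equal w~z w~z′ = earlier-neighbour-unique (Adj-sym G w~z) (Adj-sym G w~z′)

    -- At most one neighbour is earlier (the DFS parent) and at most one equals t.
    blocked-collide : ∀ {w t z₁ z₂ z₃} → Adj G w z₁ → Adj G w z₂ → Adj G w z₃ →
      Blocked w t z₁ → Blocked w t z₂ → Blocked w t z₃ → z₁ ≡ z₂ ⊎ z₁ ≡ z₃ ⊎ z₂ ≡ z₃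
    blocked-collide w~z₁ w~z₂ w~z₃ (inj₁ p₁) (inj₁ p₂) _ = inj₁ (earlier-neighbours-equal w~z₁ w~z₂ p₁ p₂)
    blocked-collide w~z₁ w~z₂ w~z₃ (inj₂ e₁) (inj₂ e₂) _ = inj₁ (trans e₁ (sym e₂))
    blocked-collide w~z₁ w~z₂ w~z₃ (inj₁ p₁) _ (inj₁ p₃) = inj₂ (inj₁ (earlier-neighbours-equal w~z₁ w~z₃ p₁ p₃))
    blocked-collide w~z₁ w~z₂ w~z₃ (inj₂ e₁) _ (inj₂ e₃) = inj₂ (inj₁ (trans e₁ (sym e₃)))
    blocked-collide w~z₁ w~z₂ w~z₃ _ (inj₁ p₂) (inj₁ p₃) = inj₂ (inj₂ (earlier-neighbours-equal w~z₂ w~z₃ p₂ p₃))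
    blocked-collide w~z₁ w~z₂ w~z₃ _ (inj₂ e₂) (inj₂ e₃) = inj₂ (inj₂ (trans e₂ (sym e₃)))

  module _ (no-deg-2 : ∀ v → deg G v ≢ 2) where

    later-neighbour : ∀ {w} → 0 < pos w → isLeafᵇ G w ≡ false → ∀ t → ∃ λ z → Adj G w z × pos w < pos z × z ≢ t
    later-neighbour {w} 0<pw non-leaf t with discovered-from w 0<pw
    ... | u , _ , u~w , _ with three-neighbours G no-deg-2 (Adj-sym G u~w) non-leaf
    ... | z₁ , z₂ , z₃ , w~z₁ , w~z₂ , w~z₃ , z₁≢z₂ , z₁≢z₃ , z₂≢z₃
      with classify t w~z₁ | classify t w~z₂ | classify t w~z₃
    ... | inj₁ later | _          | _          = z₁ , w~z₁ , later
    ... | _          | inj₁ later | _          = z₂ , w~z₂ , later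
    ... | _          | _          | inj₁ later = z₃ , w~z₃ , later
    ... | inj₂ b₁    | inj₂ b₂    | inj₂ b₃    =
      ⊥-elim ([ z₁≢z₂ , [ z₁≢z₃ , z₂≢z₃ ]′ ]′ (blocked-collide w~z₁ w~z₂ w~z₃ b₁ b₂ b₃))

    module _ (E : TreeEdge) where
      private module E = Subtree E

      private
        last-is-leaf : ∀ {ℓ} → E.inside ℓ ≡ true → suc (pos ℓ) ≡ E.end → isLeafᵇ G ℓ ≡ true
        last-is-leaf {ℓ} in-ℓ 1+pℓ≡end with isLeafᵇ G ℓ in leaf
        ... | true  = refl
        ... | false with later-neighbour (E.inside⇒nonroot in-ℓ) leaf ℓ
        ...   | z , ℓ~z , pℓ<pz , _ with E.cut ℓ~z in-ℓ (E.outside-after (subst (_≤ pos z) 1+pℓ≡end pℓ<pz))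
        ...     | refl , refl = ⊥-elim (<-asym E.parent-first pℓ<pz)

      subtree-last-leaf : ∃ λ ℓ → suc (pos ℓ) ≡ E.end × E.inside ℓ ≡ true × isLeafᵇ G ℓ ≡ true
      subtree-last-leaf with m≤n⇒∃[o]m+o≡n E.b<end
      ... | j , 1+cE+j≡end with vertex-at (≤-trans (≤-reflexive 1+cE+j≡end) E.end≤N)
      ...   | ℓ , pℓ≡cE+j = ℓ , 1+pℓ≡end , in-ℓ , last-is-leaf in-ℓ 1+pℓ≡end
        where
          1+pℓ≡end : suc (pos ℓ) ≡ E.end
          1+pℓ≡end = trans (cong suc pℓ≡cE+j) 1+cE+j≡end
          in-ℓ : E.inside ℓ ≡ true
          in-ℓ = inRange⁺ (subst (pos E.child ≤_) (sym pℓ≡cE+j) (m≤m+n _ j)) (≤-reflexive 1+pℓ≡end)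

    module _ (E F : TreeEdge) where
      private
        module E = Subtree E
        module F = Subtree F

        distinguished-by : ∀ {ℓ} → isLeafᵇ G ℓ ≡ true → E.inside ℓ ≡ true → F.inside ℓ ≡ false → ¬ SameLeaves E F
        distinguished-by leaf in-E out-F same = true≢false (trans (sym in-E) (trans (same _ leaf) out-F))

        just-before-child : pos E.child < pos F.child → F.end ≡ E.end →
          ∃ λ w → suc (pos w) ≡ pos F.child × E.inside w ≡ true × F.inside w ≡ false
        just-before-child cE<cF endF≡endE with m≤n⇒∃[o]m+o≡n (≤-<-trans z≤n cE<cF)
        ... | j , 1+j≡cF with vertex-at (≤-trans (≤-reflexive 1+j≡cF) (<⇒≤ (pos<N F.child)))
        ...   | w , pw≡j = w , 1+pw≡cF , in-E-w , F.outside-before (≤-reflexive 1+pw≡cF)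
          where
            1+pw≡cF : suc (pos w) ≡ pos F.child
            1+pw≡cF = trans (cong suc pw≡j) 1+j≡cF
            in-E-w : E.inside w ≡ true
            in-E-w = inRange⁺ (≤-pred (subst (pos E.child <_) (sym 1+pw≡cF) cE<cF))
                              (<-trans (≤-reflexive 1+pw≡cF) (subst (pos F.child <_) endF≡endE F.b<end))

        -- The vertex w discovered just before F.child is a leaf, or has a later neighbour
        -- z ≠ F.child, which then lies outside both subtrees.
        same-end-impossible : pos E.child < pos F.child → F.end ≡ E.end → ¬ SameLeaves E F
        same-end-impossible cE<cF endF≡endE same with just-before-child cE<cF endF≡endE
        ... | w , 1+pw≡cF , in-E-w , out-F-w with isLeafᵇ G w in leaf
        ...   | true  = distinguished-by leaf in-E-w out-F-w same
        ...   | false with later-neighbour (E.inside⇒nonroot in-E-w) leaf F.child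
        ...     | z , w~z , pw<pz , z≢cF with F.inside z in in-F-z
        ...       | true  = z≢cF (proj₁ (F.cut (Adj-sym G w~z) in-F-z out-F-w))
        ...       | false with E.cut w~z in-E-w (E.outside-after endE≤pz)
          where endE≤pz : E.end ≤ pos z
                endE≤pz = subst (_≤ pos z) endF≡endE (F.outside⇒after in-F-z (subst (_≤ pos z) 1+pw≡cF pw<pz))
        ...         | refl , refl = <-asym E.parent-first pw<pz

      deeper-child-impossible : pos E.child < pos F.child → ¬ SameLeaves E F
      deeper-child-impossible cE<cF same with subtree-last-leaf E
      ... | ℓ , 1+pℓ≡endE , in-E-ℓ , leaf with E.end ≤? pos F.child
      ...   | yes endE≤cF = distinguished-by leaf in-E-ℓ (F.outside-before (<-≤-trans (≤-reflexive 1+pℓ≡endE) endE≤cF)) same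
      ...   | no endE≰cF with m≤n⇒m<n∨m≡n (subtrees-nested E F cE<cF (≰⇒> endE≰cF))
      ...     | inj₁ endF<endE = distinguished-by leaf in-E-ℓ
                                   (F.outside-after (≤-pred (subst (F.end <_) (sym 1+pℓ≡endE) endF<endE))) same
      ...     | inj₂ endF≡endE = same-end-impossible cE<cF endF≡endE same

    same-leaves⇒same-edge : ∀ E F → SameLeaves E F →
      TreeEdge.parent E ≡ TreeEdge.parent F × TreeEdge.child E ≡ TreeEdge.child F
    same-leaves⇒same-edge E F same with <-cmp (pos (TreeEdge.child E)) (pos (TreeEdge.child F))
    ... | tri< cE<cF _ _ = ⊥-elim (deeper-child-impossible E F cE<cF same)
    ... | tri> _ _ cF<cE = ⊥-elim (deeper-child-impossible F E cF<cE (λ ℓ leaf → sym (same ℓ leaf)))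
    ... | tri≈ _ cE≡cF _ = earlier-neighbour-unique pE~cF (TreeEdge.parent~child F) pE<cF (TreeEdge.parent-first F)
                         , cE≡cF′
      where
        cE≡cF′ : TreeEdge.child E ≡ TreeEdge.child F
        cE≡cF′ = pos-injective cE≡cF
        pE~cF : Adj G (TreeEdge.parent E) (TreeEdge.child F)
        pE~cF = subst (Adj G (TreeEdge.parent E)) cE≡cF′ (TreeEdge.parent~child E)
        pE<cF : pos (TreeEdge.parent E) < pos (TreeEdge.child F)
        pE<cF = subst (pos (TreeEdge.parent E) <_) cE≡cF (TreeEdge.parent-first E)

-- The family of paths

module PathFamily {n : ℕ} (G : Graph n) (connected : Connected G) (acyclic : Acyclic G)
                (no-deg-2 : ∀ v → deg G v ≢ 2) (k : ℕ)
                {r : Fin n} {ord : List (Fin n)} (root-leaf : deg G r ≡ 1) (isDFS : IsDFSOrder G r ord)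
                (as bs cs : Vec (Fin n) k)
                (leaf-order : leavesInOrder G ord ≡ toList as ++ toList bs ++ toList cs)
                (P Q : Fin k → List (Fin n))
                (P-path : ∀ i → IsPath G (lookup as i) (lookup bs i) (P i))
                (Q-path : ∀ i → IsPath G (lookup as i) (lookup cs i) (Q i)) where

  open DFSTree G connected acyclic isDFS
  open LeafIntervals k

  private
    leaves : List (Fin n)
    leaves = leavesInOrder G ord

    leafRank : ℕ → ℕ
    leafRank = rank (isLeafᵇ G) ord

    leaves-length : length leaves ≡ k + (k + k)
    leaves-length = trans (cong length leaf-order)
      (trans (length-++ (toList as)) (cong₂ _+_ (length-toList as)
        (trans (length-++ (toList bs)) (cong₂ _+_ (length-toList bs) (length-toList cs)))))

    leaves-unique : Unique leaves
    leaves-unique = filter⁺ (T? ∘ isLeafᵇ G) (proj₁ (proj₂ isDFS))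

    leaf-a : ∀ i → leaves ‼ toℕ i ≡ just (lookup as i)
    leaf-a i = trans (cong (_‼ toℕ i) leaf-order) (‼-++ˡ (toList as) _ (toℕ i) (toList-‼ as i))

    leaf-b : ∀ i → leaves ‼ (k + toℕ i) ≡ just (lookup bs i)
    leaf-b i = trans (cong (_‼ (k + toℕ i)) leaf-order)
               (trans (‼-toList-++ as _ (toℕ i)) (‼-++ˡ (toList bs) _ (toℕ i) (toList-‼ bs i)))

    leaf-c : ∀ i → leaves ‼ (k + (k + toℕ i)) ≡ just (lookup cs i)
    leaf-c i = trans (cong (_‼ (k + (k + toℕ i))) leaf-order)
               (trans (‼-toList-++ as _ (k + toℕ i)) (trans (‼-toList-++ bs _ (toℕ i)) (toList-‼ cs i)))

    leaf-index-injective : ∀ {j j′ w w′} → leaves ‼ j ≡ just w → leaves ‼ j′ ≡ just w′ → w ≡ w′ → j ≡ j′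
    leaf-index-injective e e′ refl = Unique⇒‼-injective leaves-unique _ _ e e′

    a-injective : ∀ {i i′} → lookup as i ≡ lookup as i′ → i ≡ i′
    a-injective {i} {i′} e = toℕ-injective (leaf-index-injective (leaf-a i) (leaf-a i′) e)

    b≢c : ∀ i i′ → lookup bs i ≢ lookup cs i′
    b≢c i i′ e = <⇒≱ (toℕ<n i) (subst (k ≤_) (sym i≡k+i′) (m≤m+n k (toℕ i′)))
      where i≡k+i′ : toℕ i ≡ k + toℕ i′
            i≡k+i′ = +-cancelˡ-≡ k _ _ (leaf-index-injective (leaf-b i) (leaf-c i′) e)

    same-start : ∀ {u v u′ v′ L L′} → IsPath G u v L → IsPath G u′ v′ L′ → L ≡ L′ → u ≡ u′
    same-start p p′ refl = just-injective (trans (sym (IsPath-head G p)) (IsPath-head G p′))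

    same-end : ∀ {u v u′ v′ L L′} → IsPath G u v L → IsPath G u′ v′ L′ → L ≡ L′ → v ≡ v′
    same-end p p′ refl = just-injective (trans (sym (IsPath-last G p)) (IsPath-last G p′))

    rank-one : leafRank 1 ≡ 1
    rank-one = rank-suc (isLeafᵇ G) ord 0 (subst (λ m → ord ‼ m ≡ just r) pos-root (ord-at-pos r))
                        (cong (_≡ᵇ 1) root-leaf)

  module LeafInterval (E : TreeEdge) where
    open Subtree E

    start stop : ℕ
    start = leafRank (pos child)
    stop  = leafRank end

    1≤start : 1 ≤ start
    1≤start = subst (_≤ start) rank-one (rank-mono (isLeafᵇ G) ord (<-≤-trans (s≤s z≤n) parent-first))

    start<stop : start < stop
    start<stop with subtree-last-leaf no-deg-2 E
    ... | ℓ , 1+pℓ≡end , in-ℓ , leaf = ≤-<-trans (rank-mono (isLeafᵇ G) ord (proj₁ (inRange⁻ in-ℓ)))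
                                                  (rank-strict (isLeafᵇ G) ord (ord-at-pos ℓ) leaf (≤-reflexive 1+pℓ≡end))

    stop≤3k : stop ≤ k + (k + k)
    stop≤3k = subst (stop ≤_) leaves-length (rank≤length-filter (isLeafᵇ G) ord end)

    inside-leaf : ∀ {j w} → leaves ‼ j ≡ just w → inside w ≡ inRange start stop j
    inside-leaf {j} {w} e with ‼-filter⁻ (isLeafᵇ G) ord j e
    ... | m , ord-m , rank≡j , leaf = begin
      inRange (pos child) end (pos w)                          ≡⟨ cong (inRange (pos child) end) (sym (pos-unique ord-m)) ⟩
      inRange (pos child) end m                                ≡⟨ sym (inRange-rank (isLeafᵇ G) ord ord-m leaf) ⟩
      inRange start stop (leafRank m)                          ≡⟨ cong (inRange start stop) rank≡j ⟩
      inRange start stop j                                     ∎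
      where open ≡-Reasoning

    crosses⇔ : ∀ {j j′ u v L} → IsPath G u v L → leaves ‼ j ≡ just u → leaves ‼ j′ ≡ just v →
      EdgeIn G parent child L ⇔ (inRange start stop j xor inRange start stop j′ ≡ true)
    crosses⇔ {j} {j′} {u} {v} {L} path eu ev =
      mk⇔ (λ c → trans (sym sides) (Equivalence.to crossing c)) (λ s → Equivalence.from crossing (trans sides s))
      where
        crossing : EdgeIn G parent child L ⇔ (side u xor side v ≡ true)
        crossing = path-crosses⇔ path
        sides : side u xor side v ≡ inRange start stop j xor inRange start stop j′
        sides = cong₂ _xor_ (trans (side≡inRange u) (inside-leaf eu)) (trans (side≡inRange v) (inside-leaf ev))

    P-crosses⇔ : ∀ i → EdgeIn G parent child (P i) ⇔ (splitsAB start stop i ≡ true)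
    P-crosses⇔ i = crosses⇔ (P-path i) (leaf-a i) (leaf-b i)

    Q-crosses⇔ : ∀ i → EdgeIn G parent child (Q i) ⇔ (splitsAC start stop i ≡ true)
    Q-crosses⇔ i = crosses⇔ (Q-path i) (leaf-a i) (leaf-c i)

    some-path-crosses : ∃ λ j → EdgeIn G parent child (family P Q j)
    some-path-crosses with some-split 1≤start start<stop stop≤3k
    ... | i , inj₁ ab = inj₁ i , Equivalence.from (P-crosses⇔ i) ab
    ... | i , inj₂ ac = inj₂ i , Equivalence.from (Q-crosses⇔ i) ac

  covers : Covers G (family P Q)
  covers x y (_ , x~y) with orient x~y
  ... | E , o with LeafInterval.some-path-crosses E
  ...   | j , crosses = j , Equivalence.from (Orientation-EdgeIn o) crosses

  separates : Separates G (family P Q)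
  separates x y x′ y′ (x<y , x~y) (x′<y′ , x′~y′) xy≢x′y′ same-family with orient x~y | orient x′~y′
  ... | E , oE | F , oF = distinct oE oF (same-leaves⇒same-edge no-deg-2 E F same-leaves)
    where
      module E = LeafInterval E
      module F = LeafInterval F
      edges⇔ : ∀ j → EdgeIn G (TreeEdge.parent E) (TreeEdge.child E) (family P Q j)
                   ⇔ EdgeIn G (TreeEdge.parent F) (TreeEdge.child F) (family P Q j)
      edges⇔ j = ⇔-trans (⇔-sym (Orientation-EdgeIn oE)) (⇔-trans (same-family j) (Orientation-EdgeIn oF))
      same-interval : E.start ≡ F.start × E.stop ≡ F.stop
      same-interval = splits-injective E.1≤start E.start<stop E.stop≤3k F.1≤start F.start<stop F.stop≤3k
        (λ i → Bool-⇔⇒≡ (⇔-trans (⇔-sym (E.P-crosses⇔ i)) (⇔-trans (edges⇔ (inj₁ i)) (F.P-crosses⇔ i))))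
        (λ i → Bool-⇔⇒≡ (⇔-trans (⇔-sym (E.Q-crosses⇔ i)) (⇔-trans (edges⇔ (inj₂ i)) (F.Q-crosses⇔ i))))
      same-leaves : SameLeaves E F
      same-leaves ℓ leaf = trans (E.inside-leaf ℓ-index)
        (trans (cong₂ (λ s t → inRange s t (leafRank (pos ℓ))) (proj₁ same-interval) (proj₂ same-interval))
               (sym (F.inside-leaf ℓ-index)))
        where ℓ-index : leaves ‼ leafRank (pos ℓ) ≡ just ℓ
              ℓ-index = filter-‼-rank (isLeafᵇ G) ord (pos ℓ) (ord-at-pos ℓ) leaf
      distinct : Orientation x y E → Orientation x′ y′ F →
                 TreeEdge.parent E ≡ TreeEdge.parent F × TreeEdge.child E ≡ TreeEdge.child F → ⊥
      distinct (forward refl refl)  (forward refl refl)  (refl , refl) = xy≢x′y′ refl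
      distinct (backward refl refl) (backward refl refl) (refl , refl) = xy≢x′y′ refl
      distinct (forward refl refl)  (backward refl refl) (refl , refl) = <F-asym x<y x′<y′
      distinct (backward refl refl) (forward refl refl)  (refl , refl) = <F-asym x<y x′<y′

  injective : Injective _≡_ _≡_ (family P Q)
  injective {inj₁ i} {inj₁ i′} Pi≡Pi′ = cong inj₁ (a-injective (same-start (P-path i) (P-path i′) Pi≡Pi′))
  injective {inj₂ i} {inj₂ i′} Qi≡Qi′ = cong inj₂ (a-injective (same-start (Q-path i) (Q-path i′) Qi≡Qi′))
  injective {inj₁ i} {inj₂ i′} Pi≡Qi′ = ⊥-elim (b≢c i i′ (same-end (P-path i) (Q-path i′) Pi≡Qi′))
  injective {inj₂ i} {inj₁ i′} Qi≡Pi′ = ⊥-elim (b≢c i′ i (same-end (P-path i′) (Q-path i) (sym Qi≡Pi′)))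

-- The hypotheses 3 ≤ n, 1 ≤ k and numLeaves G ≡ 3 * k are unused: they follow from the others.
lemma4p3 : ∀ {n} (G : Graph n) → IsTree G → 3 ≤ n → (∀ v → deg G v ≢ 2) →
    ∀ k → 1 ≤ k → numLeaves G ≡ 3 * k →
    (ord : List (Fin n)) → IsDFSFromLeaf G ord →
    (as bs cs : Vec (Fin n) k) →
    leavesInOrder G ord ≡ toList as ++ toList bs ++ toList cs →
    (P Q : Fin k → List (Fin n)) →
    (∀ i → IsPath G (lookup as i) (lookup bs i) (P i)) →
    (∀ i → IsPath G (lookup as i) (lookup cs i) (Q i)) →
    Separates G (family P Q) × Covers G (family P Q)
      × Injective _≡_ _≡_ (family P Q)
lemma4p3 G (connected , acyclic) _ no-deg-2 k _ _ ord (r , root-leaf , isDFS) as bs cs leaf-order P Q P-path Q-path =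
  separates , covers , injective
  where open PathFamily G connected acyclic no-deg-2 k root-leaf isDFS as bs cs leaf-order P Q P-path Q-path
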